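{- In the Warden's Game with position set $\mathbf{S}$ and goal $\alpha$, let $m$ be a positive integer. If there is no position $\beta\in\mathbf{S}$ with $r(\beta)=m$, then there is no position $\beta\in\mathbf{S}$ with $r(\beta)=m+1$ (and hence, by induction, none with $r(\beta)=m'$ for any integer $m'\ge m$).
   Context: $\mathbf{T}(n,k)$ is the set of strings of length $n$ over $\{1,\ldots,k\}$; $\mathbf{S}\subseteq\mathbf{T}(n,k)$ is closed under rotations (cyclic shifts), and $\alpha\in\mathbf{S}$. Warden's Game: positions are elements of $\mathbf{S}$. From a position $\gamma c$ ($\gamma$ of length $n-1$, $c$ the last symbol), the warden may either move to $c'\gamma$ for some symbol $c'<c$ with $c'\gamma\in\mathbf{S}$, or pass; if he passes, the prisoner must move to $c'\gamma$ for some symbol $c'\ge c$ with $c'\gamma\in\mathbf{S}$. The game ends (prisoner wins) as soon as the position equals $\alpha$ after some move. Remoteness: for $\beta\in\mathbf{S}$, $r(\beta)$ is the number of moves the game lasts starting from $\beta$ when both players play optimally (the prisoner minimizing and the warden maximizing the number of moves until $\alpha$ is reached after a move); $r(\beta)=\infty$ if the warden can prevent $\alpha$ from ever being reached. In particular $r(\alpha)\ge1$, as $\alpha$ is treated as a starting position. -}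

module Defs where

open import Data.Nat using (ℕ; zero; suc; _∸_)
open import Data.Fin using (Fin) renaming (_<_ to _<ᶠ_; _≤_ to _≤ᶠ_)
open import Data.Vec using (Vec; _∷_; init; last)
open import Data.Product using (_×_; ∃-syntax; Σ-syntax)
open import Data.Sum using (_⊎_)
open import Data.Empty using (⊥)
open import Relation.Nullary using (¬_)
open import Relation.Binary.PropositionalEquality using (_≡_)

-- Strings of length (suc n) over the alphabet Fin k (symbols 1..k are
-- represented by 0..k-1, order preserved).  Paper's length n ≥ 1 is
-- suc n here (a string needs a last symbol for the game to make sense).
Str : ℕ → ℕ → Set
Str k n = Vec (Fin k) (suc n)

rotate : ∀ {k n} → Str k n → Str k n
rotate β = last β ∷ init β

-- S closed under rotations (one-step rotation generates all cyclic shifts)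
RotClosed : ∀ {k n} → (Str k n → Set) → Set
RotClosed {k} {n} S = ∀ (β : Str k n) → S β → S (rotate β)

module WardensGame {k n : ℕ} (S : Str k n → Set) (α : Str k n) where

  mutual
    -- Win t β : from position β the prisoner can force that the position
    -- equals α after some move, within at most t moves, whatever the warden does.
    Win : ℕ → Str k n → Set
    Win zero β = ⊥
    Win (suc t) β =
      -- every warden move γc ↦ c'γ (c' < c, c'γ ∈ S) leads to a good outcome
      (∀ (c' : Fin k) → c' <ᶠ last β → S (c' ∷ init β) → Done t (c' ∷ init β))
      -- and if the warden passes, the prisoner has a good move γc ↦ c'γ (c' ≥ c)
      × (∃[ c' ] (last β ≤ᶠ c' × S (c' ∷ init β) × Done t (c' ∷ init β)))

    Done : ℕ → Str k n → Set
    Done t δ = δ ≡ α ⊎ Win t δ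

  Remoteness : Str k n → ℕ → Set
  Remoteness β m = Win m β × ¬ Win (m ∸ 1) β

-- If no position has remoteness t + 1, then any position the prisoner wins within t + 1 moves
-- is, up to double negation, already won within t moves.  Applying this to the children of a
-- position won within t + 2 moves shows that it is (again up to double negation) won within
-- t + 1 moves, so it cannot have remoteness t + 2.  Double negation is unavoidable because S
-- is an arbitrary predicate; it is harmless since remoteness is refuted, i.e. the goal is ⊥.
module Submission where

open import Defs
open import Level using (0ℓ)
open import Data.Nat using (ℕ; zero; suc; _≤_; s≤s; z≤n; _≤′_; ≤′-reflexive; ≤′-refl; ≤′-step)
open import Data.Nat.Properties using (≤⇒≤′)
open import Data.Fin using (Fin) renaming (zero to fzero; suc to fsuc)
open import Data.Product using (_×_; ∃-syntax; _,_)
open import Data.Sum using (inj₁; inj₂)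
open import Data.Empty using (⊥-elim)
open import Effect.Monad using (RawMonad)
open import Relation.Nullary using (¬_)
open import Relation.Nullary.Negation using (DoubleNegation; ¬¬-Monad)

open RawMonad (¬¬-Monad {a = 0ℓ}) using (_>>=_; pure)

¬¬-Π : {A B : Set} → (A → DoubleNegation B) → DoubleNegation (A → B)
¬¬-Π f ¬g = ¬g (λ a → ⊥-elim (f a (λ b → ¬g (λ _ → b))))

¬¬-Π-Fin : ∀ {k} {P : Fin k → Set} → (∀ i → DoubleNegation (P i)) →
           DoubleNegation (∀ i → P i)
¬¬-Π-Fin {zero} f = pure (λ ())
¬¬-Π-Fin {suc k} {P} f = do
  p₀ ← f fzero
  ps ← ¬¬-Π-Fin {k} {λ i → P (fsuc i)} (λ i → f (fsuc i))
  pure λ { fzero → p₀ ; (fsuc i) → ps i }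

module _ {k n : ℕ} (S : Str k n → Set) (α : Str k n) where
  open WardensGame S α

  NoPositionOfRemoteness : ℕ → Set
  NoPositionOfRemoteness m = ¬ (∃[ β ] (S β × Remoteness β m))

  module _ {t : ℕ} (none : NoPositionOfRemoteness (suc t)) where

    ¬¬done-pred : ∀ {δ} → S δ → Done (suc t) δ → DoubleNegation (Done t δ)
    ¬¬done-pred _ (inj₁ δ≡α) = pure (inj₁ δ≡α)
    ¬¬done-pred sδ (inj₂ win) ¬done = none (_ , sδ , win , λ win′ → ¬done (inj₂ win′))

    ¬¬win-pred : ∀ {β} → Win (suc (suc t)) β → DoubleNegation (Win (suc t) β)
    ¬¬win-pred (wardenMoves , c , c≥ , sc , done) = do
      wardenMoves′ ← ¬¬-Π-Fin λ c′ → ¬¬-Π λ c′< → ¬¬-Π λ s →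
                       ¬¬done-pred s (wardenMoves c′ c′< s)
      done′ ← ¬¬done-pred sc done
      pure (wardenMoves′ , c , c≥ , sc , done′)

    noPositionOfRemoteness-suc : NoPositionOfRemoteness (suc (suc t))
    noPositionOfRemoteness-suc (β , sβ , win , ¬win) = ¬¬win-pred win ¬win

  noPositionOfRemoteness-≥ : ∀ {t m} → suc t ≤′ m →
    NoPositionOfRemoteness (suc t) → NoPositionOfRemoteness m
  noPositionOfRemoteness-≥ ≤′-refl none = none
  noPositionOfRemoteness-≥ (≤′-step {zero} (≤′-reflexive ()))
  noPositionOfRemoteness-≥ (≤′-step {suc _} t<m) none =
    noPositionOfRemoteness-suc (noPositionOfRemoteness-≥ t<m none)

mainTheorem4 : ∀ {k n : ℕ} (S : Str k n → Set) (α : Str k n) →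
    RotClosed S → S α → (m : ℕ) → 1 ≤ m →
    ¬ (∃[ β ] (S β × WardensGame.Remoteness S α β m)) →
    ¬ (∃[ β ] (S β × WardensGame.Remoteness S α β (suc m)))
      × (∀ (m' : ℕ) → m ≤ m' → ¬ (∃[ β ] (S β × WardensGame.Remoteness S α β m')))
mainTheorem4 S α _ _ (suc t) (s≤s z≤n) none =
  noPositionOfRemoteness-suc S α none ,
  λ m′ m≤m′ → noPositionOfRemoteness-≥ S α (≤⇒≤′ m≤m′) none
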